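{- Let $\sigma$ be a maximal repeat in a word $w$. Then $\sigma$ is the principal repeat of some maximal repetition or of some maximal subrepetition of $w$ if and only if the minimal period of $\mathrm{fact}(\sigma)$ equals $p(\sigma)$.
   Context: $w$ is a word of length $n$. For a factor $w[i..j]$ we write $\mathrm{beg}=i$ and $\mathrm{end}=j$. A period of a word $x$ is any $p$ with $x[i]=x[i+p]$ for all valid $i$; $p(x)$ is the minimal period and $e(x)=|x|/p(x)$. A factor $r$ is maximal if two conditions hold: if $\mathrm{beg}(r)>1$ then $w[\mathrm{beg}(r)-1]\ne w[\mathrm{beg}(r)+p(r)-1]$, and if $\mathrm{end}(r)<n$ then $w[\mathrm{end}(r)-p(r)+1]\ne w[\mathrm{end}(r)+1]$. A repetition is a factor with $e\ge 2$; a subrepetition is a factor with $1<e<2$. A repeat $\sigma$ is a pair $(u',u'')$ of nonempty factors of $w$ that are equal as words, with $\mathrm{beg}(u')<\mathrm{beg}(u'')$. Its period is $p(\sigma)=\mathrm{beg}(u'')-\mathrm{beg}(u')$, and $\mathrm{fact}(\sigma)=w[\mathrm{beg}(u')..\mathrm{end}(u'')]$. The repeat is maximal if two conditions hold: if $\mathrm{beg}(u')>1$ then $w[\mathrm{beg}(u')-1]\ne w[\mathrm{beg}(u'')-1]$, and if $\mathrm{end}(u'')<n$ then $w[\mathrm{end}(u')+1]\ne w[\mathrm{end}(u'')+1]$. The principal repeat of a maximal repetition or maximal subrepetition $r$ is the repeat with copies $w[\mathrm{beg}(r)..\mathrm{end}(r)-p(r)]$ and $w[\mathrm{beg}(r)+p(r)..\mathrm{end}(r)]$.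 -}

module Defs where

open import Data.Nat using (ℕ; zero; suc; _+_; _*_; _∸_; _≤_; _<_)
open import Data.List using (List; []; _∷_; length)
open import Data.Maybe using (Maybe; just; nothing)
open import Data.Product using (Σ; _×_; _,_; ∃-syntax)
open import Data.Sum using (_⊎_)
open import Relation.Binary.PropositionalEquality using (_≡_; _≢_)

-- Positions are 0-based: the word w has letters at positions 0 .. length w ∸ 1.
-- (The paper is 1-based; all conditions are shifted uniformly.)
-- A factor w[i..j] (inclusive bounds) is given by i ≤ j < length w.

-- Letter lookup (nothing outside the word; only used at in-range positions).
at : {A : Set} → List A → ℕ → Maybe A
at []       _       = nothing
at (x ∷ xs) zero    = just x
at (x ∷ xs) (suc k) = at xs k

module _ {A : Set} (w : List A) where

  flen : ℕ → ℕ → ℕ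
  flen i j = suc j ∸ i

  HasPeriod : ℕ → ℕ → ℕ → Set
  HasPeriod i j p =
    1 ≤ p × p ≤ flen i j ×
    (∀ k → i ≤ k → k + p ≤ j → at w k ≡ at w (k + p))

  IsMinPeriod : ℕ → ℕ → ℕ → Set
  IsMinPeriod i j p = HasPeriod i j p × (∀ q → HasPeriod i j q → p ≤ q)

  IsFactor : ℕ → ℕ → Set
  IsFactor i j = i ≤ j × j < length w

  IsMaximalFactor : ℕ → ℕ → ℕ → Set
  IsMaximalFactor i j p =
    (0 < i → at w (i ∸ 1) ≢ at w (i ∸ 1 + p)) ×
    (suc j < length w → at w (suc j ∸ p) ≢ at w (suc j))

  -- repetition: e ≥ 2, i.e. |r| ≥ 2 p(r)
  IsRepetition : ℕ → ℕ → ℕ → Set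
  IsRepetition i j p = 2 * p ≤ flen i j

  -- subrepetition: 1 < e < 2, i.e. p(r) < |r| < 2 p(r)
  IsSubrepetition : ℕ → ℕ → ℕ → Set
  IsSubrepetition i j p = p < flen i j × flen i j < 2 * p

  -- A repeat σ = (u', u'') with u' = w[b₁ .. b₁+L-1], u'' = w[b₂ .. b₂+L-1],
  -- L ≥ 1, b₁ < b₂, both copies inside w and equal as words.
  IsRepeat : ℕ → ℕ → ℕ → Set
  IsRepeat b₁ b₂ L =
    1 ≤ L × b₁ < b₂ × b₂ + L ≤ length w ×
    (∀ k → k < L → at w (b₁ + k) ≡ at w (b₂ + k))

  IsMaximalRepeat : ℕ → ℕ → ℕ → Set
  IsMaximalRepeat b₁ b₂ L =
    IsRepeat b₁ b₂ L ×
    (0 < b₁ → at w (b₁ ∸ 1) ≢ at w (b₂ ∸ 1)) ×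
    (b₂ + L < length w → at w (b₁ + L) ≢ at w (b₂ + L))

  repPeriod : ℕ → ℕ → ℕ
  repPeriod b₁ b₂ = b₂ ∸ b₁

  -- fact(σ) = w[beg(u') .. end(u'')] = w[b₁ .. b₂+L-1]; its end position:
  factEnd : ℕ → ℕ → ℕ → ℕ
  factEnd b₁ b₂ L = b₂ + L ∸ 1

  -- σ is the principal repeat of some maximal repetition or maximal
  -- subrepetition r = w[i..j] with p(r) = p: the copies of σ are
  -- w[i .. j-p] and w[i+p .. j].
  IsPrincipalRepeatOfMaxRepOrSubrep : ℕ → ℕ → ℕ → Set
  IsPrincipalRepeatOfMaxRepOrSubrep b₁ b₂ L =
    ∃[ i ] ∃[ j ] ∃[ p ]
      IsFactor i j × IsMinPeriod i j p ×
      (IsRepetition i j p ⊎ IsSubrepetition i j p) ×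
      IsMaximalFactor i j p ×
      (b₁ ≡ i × b₂ ≡ i + p × b₁ + L ∸ 1 ≡ j ∸ p × b₂ + L ∸ 1 ≡ j)

-- Both sides express one fact about fact(σ) = w[b₁ .. b₂+L-1]: that its minimal period is
-- b₂ − b₁.  The principal repeat of r = w[i..j] determines i, j and p(r), so it transports the
-- minimal period of r to fact(σ).  Conversely, if fact(σ) has minimal period p(σ) it is longer
-- than p(σ) (the copies are nonempty), hence a repetition or a subrepetition, and the two
-- maximality conditions of σ are, letter for letter, those of fact(σ) as a factor of period p(σ).
module Submission where

open import Defs
open import Data.Nat using (ℕ; zero; suc; _+_; _*_; _∸_; _<_; s≤s; _≤?_)
open import Data.Nat.Properties
  using (m≤m+n; m≤n+m; ≤-trans; ≤-reflexive; <⇒≤; ≰⇒>; +-assoc; +-suc; +-∸-comm;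
         m+n∸n≡m; m+n∸m≡n; m≤n⇒∃[o]m+o≡n)
open import Data.List using (List; length)
open import Data.Product using (_,_)
open import Data.Sum using (_⊎_; inj₁; inj₂)
open import Relation.Nullary using (yes; no)
open import Relation.Binary.PropositionalEquality using (_≡_; _≢_; refl; sym; trans; cong; subst; subst₂)
open import Function.Bundles using (_⇔_; mk⇔)

m+n+o∸n≡m+o : ∀ m n o → m + n + o ∸ n ≡ m + o
m+n+o∸n≡m+o m n o = trans (+-∸-comm o (m≤n+m n m)) (cong (_+ o) (m+n∸n≡m m n))

module _ {A : Set} (w : List A) where

  flen-+ : ∀ i n → flen w i (i + n) ≡ suc n
  flen-+ zero    n = refl
  flen-+ (suc i) n = flen-+ i n

  repetition⊎subrepetition : ∀ i j {p} → p < flen w i j →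
                             IsRepetition w i j p ⊎ IsSubrepetition w i j p
  repetition⊎subrepetition i j {p} p<len with 2 * p ≤? flen w i j
  ... | yes 2p≤len = inj₁ 2p≤len
  ... | no  2p≰len = inj₂ (p<len , ≰⇒> 2p≰len)

  maximalRepeat⇒maximalFactor : ∀ {i p l} → IsMaximalRepeat w i (i + p) (suc l) →
                                IsMaximalFactor w i (i + p + l) p
  maximalRepeat⇒maximalFactor {i} {p} {l} (_ , left , right) = left′ , right′
    where
    left′ : 0 < i → at w (i ∸ 1) ≢ at w (i ∸ 1 + p)
    left′ 0<i rewrite sym (+-∸-comm p 0<i) = left 0<i
    right′ : suc (i + p + l) < length w → at w (suc (i + p + l) ∸ p) ≢ at w (suc (i + p + l))
    right′ rewrite sym (+-suc (i + p) l) | m+n+o∸n≡m+o i p (suc l) = right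

  principal⇒minPeriod : ∀ {b₁ b₂ L} → IsPrincipalRepeatOfMaxRepOrSubrep w b₁ b₂ L →
                        IsMinPeriod w b₁ (factEnd w b₁ b₂ L) (repPeriod w b₁ b₂)
  principal⇒minPeriod (i , _ , p , _ , minPeriod , _ , _ , refl , refl , _ , refl) =
    subst (IsMinPeriod w i _) (sym (m+n∸m≡n i p)) minPeriod

  minPeriod⇒principal : ∀ {b p l} → IsMaximalRepeat w b (b + p) (suc l) →
                        IsMinPeriod w b (factEnd w b (b + p) (suc l)) (repPeriod w b (b + p)) →
                        IsPrincipalRepeatOfMaxRepOrSubrep w b (b + p) (suc l)
  minPeriod⇒principal {b} {p} {l} σ@((_ , _ , inWord , _) , _) minPeriod =
    b , b + p + l , p ,
    (≤-trans (m≤m+n b p) (m≤m+n (b + p) l) , ≤-trans (≤-reflexive (sym (+-suc (b + p) l))) inWord) ,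
    subst₂ (IsMinPeriod w b) factEnd≡ (m+n∸m≡n b p) minPeriod ,
    repetition⊎subrepetition b (b + p + l) longerThanPeriod ,
    maximalRepeat⇒maximalFactor σ ,
    refl , refl , trans (cong (_∸ 1) (+-suc b l)) (sym (m+n+o∸n≡m+o b p l)) , factEnd≡
    where
    factEnd≡ : factEnd w b (b + p) (suc l) ≡ b + p + l
    factEnd≡ = cong (_∸ 1) (+-suc (b + p) l)
    longerThanPeriod : p < flen w b (b + p + l)
    longerThanPeriod rewrite +-assoc b p l | flen-+ b (p + l) = s≤s (m≤m+n p l)

proposition9 : {A : Set} (w : List A) (b₁ b₂ L : ℕ) →
    IsMaximalRepeat w b₁ b₂ L →
    (IsPrincipalRepeatOfMaxRepOrSubrep w b₁ b₂ L ⇔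
     IsMinPeriod w b₁ (factEnd w b₁ b₂ L) (repPeriod w b₁ b₂))
proposition9 w b₁ b₂ zero ((() , _) , _)
proposition9 w b₁ b₂ (suc l) σ@((_ , b₁<b₂ , _) , _) with m≤n⇒∃[o]m+o≡n (<⇒≤ b₁<b₂)
... | _ , refl = mk⇔ (principal⇒minPeriod w) (minPeriod⇒principal w σ)
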